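{- If $G$ is a connected graph with $n(G)\ge 2$, then $$\chi_{\rho}(M(G))\le \min\{ n(G) + 2,\ 2(n(G)-\alpha(G)+1)\}.$$
   Context: All graphs are finite and simple; $n(G)$ is the number of vertices and $\alpha(G)$ the independence number of $G$. For a positive integer $i$, an $i$-packing in $G$ is a set $W\subseteq V(G)$ such that any two distinct vertices of $W$ are at distance greater than $i$ in $G$. The packing chromatic number $\chi_{\rho}(G)$ is the smallest integer $k$ such that $V(G)$ can be partitioned into sets $V_1,\dots,V_k$ with $V_i$ an $i$-packing for each $i\in\{1,\dots,k\}$. The Mycielskian $M(G)$ of $G$ is the graph with vertex set $V(G)\cup V'\cup\{w\}$, where $V'=\{x' : x\in V(G)\}$ is a set of new vertices and $w$ is a further new vertex, and edge set $E(G)\cup\{xy' : xy\in E(G)\}\cup\{wx' : x'\in V'\}$. -}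

module Defs where

open import Data.Nat using (ℕ; zero; suc; _+_; _≤_)
open import Data.Bool using (Bool; true; false)
open import Data.Fin using (Fin; zero; suc; toℕ; splitAt)
open import Data.Fin.Subset using (Subset; _∈_; ∣_∣)
open import Data.Sum using (_⊎_; inj₁; inj₂)
open import Data.Product using (Σ; ∃; _×_)
open import Relation.Binary.PropositionalEquality using (_≡_; _≢_)
open import Relation.Nullary using (¬_)

Graph : ℕ → Set
Graph n = Fin n → Fin n → Bool

IsSimple : ∀ {n} → Graph n → Set
IsSimple {n} G = (∀ (u v : Fin n) → G u v ≡ G v u) × (∀ (u : Fin n) → G u u ≡ false)

-- Within G k u v : there is a walk of length at most k from u to v,
-- i.e. the distance d_G(u,v) is at most k.
data Within {n} (G : Graph n) : ℕ → Fin n → Fin n → Set where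
  here : ∀ {k u} → Within G k u u
  step : ∀ {k u w v} → G u w ≡ true → Within G k w v → Within G (suc k) u v

Connected : ∀ {n} → Graph n → Set
Connected {n} G = ∀ (u v : Fin n) → ∃ λ k → Within G k u v

IsIndependent : ∀ {n} → Graph n → Subset n → Set
IsIndependent {n} G S = ∀ (u v : Fin n) → u ∈ S → v ∈ S → G u v ≡ false

IsIndependenceNumber : ∀ {n} → Graph n → ℕ → Set
IsIndependenceNumber {n} G a =
  (Σ (Subset n) λ S → IsIndependent G S × ∣ S ∣ ≡ a)
  × (∀ (S : Subset n) → IsIndependent G S → ∣ S ∣ ≤ a)

-- A packing k-coloring: colour c v = j (j : Fin k) means v ∈ V_{j+1};
-- the class V_i must be an i-packing: distinct vertices of colour i are at
-- distance > i.
IsPackingColoring : ∀ {n} → Graph n → (k : ℕ) → (Fin n → Fin k) → Set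
IsPackingColoring {n} G k c =
  ∀ (u v : Fin n) → u ≢ v → c u ≡ c v → ¬ Within G (suc (toℕ (c u))) u v

χρ≤ : ∀ {n} → Graph n → ℕ → Set
χρ≤ {n} G m = Σ ℕ λ k → k ≤ m × Σ (Fin n → Fin k) λ c → IsPackingColoring G k c

-- Vertices of the Mycielskian: zero is w; suc i with i < n is the original
-- vertex i; suc (n + i) is the copy i'.
MVertex : ℕ → Set
MVertex n = Fin (suc (n + n))

data MKind (n : ℕ) : Set where
  orig : Fin n → MKind n
  copy : Fin n → MKind n
  wv   : MKind n

kind : ∀ {n} → MVertex n → MKind n
kind zero = wv
kind {n} (suc i) with splitAt n i
... | inj₁ x = orig x
... | inj₂ x = copy x

MAdj : ∀ {n} → Graph n → MKind n → MKind n → Bool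
MAdj G (orig x) (orig y) = G x y
MAdj G (orig x) (copy y) = G x y
MAdj G (copy x) (orig y) = G x y
MAdj G (copy x) (copy y) = false
MAdj G (copy x) wv       = true
MAdj G wv       (copy y) = true
MAdj G (orig x) wv       = false
MAdj G wv       (orig y) = false
MAdj G wv       wv       = false

Mycielskian : ∀ {n} → Graph n → Graph (suc (n + n))
Mycielskian G u v = MAdj G (kind u) (kind v)

module Submission where

-- In any graph H, if I is an independent set, then giving every
-- vertex of I colour 1 and every remaining vertex its own colour among
-- 2, 3, … is a packing colouring: two vertices of colour 1 are distinct and
-- non-adjacent, hence at distance > 1, and every other colour class is a
-- singleton.  This uses 1 + (n(H) − |I|) colours.
--
-- In the Mycielskian M(G), for sets P, Q ⊆ V(G) the set P ∪ Q' is independent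
-- as soon as P is independent and there is no edge of G between P and Q
-- (copies are pairwise non-adjacent).  Two choices give the two bounds:
--   * P = ∅, Q = V(G):  |I| = n, so 1 + (2n + 1 − n) = n + 2 colours;
--   * P = Q = S with S a maximum independent set of G:  |I| = 2α, so
--     1 + (2n + 1 − 2α) = 2(n − α + 1) colours.

open import Defs
open import Data.Nat using (ℕ; zero; suc; _+_; _*_; _∸_; _≤_; _⊓_; s≤s)
open import Data.Nat.Properties
  using (⊓-sel; +-suc; +-comm; m+n∸n≡m; ≤-reflexive)
open import Data.Nat.Tactic.RingSolver using (solve-∀)
open import Data.Bool using (false; true)
open import Data.Fin using (Fin; zero; suc; splitAt)
open import Data.Fin.Properties using (suc-injective)
open import Data.Fin.Subset using (Subset; _∈_; ∣_∣; ∁; ⊤; inside; outside) renaming (⊥ to ∅)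
open import Data.Fin.Subset.Properties
  using (_∈?_; x∉p⇒x∈∁p; ∣∁p∣≡n∸∣p∣; ∉⊥; ∣⊥∣≡0; ∣⊤∣≡n; ∣p∣≤n)
open import Data.Vec using ([]; _∷_; _++_; here; there)
open import Data.Vec.Properties using (lookup-splitAt; []=⇒lookup; lookup⇒[]=)
open import Data.Sum using (_⊎_; inj₁; inj₂)
open import Data.Product using (_,_)
open import Data.Empty using (⊥; ⊥-elim)
open import Relation.Binary.PropositionalEquality
open import Relation.Nullary using (Dec; yes; no)
open import Function using (case_of_)

-- Enumerating a subset: the members of p, in increasing order, are numbered
-- 0, 1, …, |p| − 1.  Used to give the vertices outside an independent set
-- pairwise different colours.
rank : ∀ {N} (p : Subset N) {x : Fin N} → x ∈ p → Fin ∣ p ∣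
rank (inside  ∷ p) here      = zero
rank (inside  ∷ p) (there m) = suc (rank p m)
rank (outside ∷ p) (there m) = rank p m

rank-injective : ∀ {N} (p : Subset N) {x y : Fin N} (x∈p : x ∈ p) (y∈p : y ∈ p)
               → rank p x∈p ≡ rank p y∈p → x ≡ y
rank-injective (inside  ∷ p) here       here       _ = refl
rank-injective (inside  ∷ p) (there x∈) (there y∈) e =
  cong suc (rank-injective p x∈ y∈ (suc-injective e))
rank-injective (outside ∷ p) (there x∈) (there y∈) e =
  cong suc (rank-injective p x∈ y∈ e)
rank-injective (inside  ∷ p) here       (there _)  ()
rank-injective (inside  ∷ p) (there _)  here       ()

within-1 : ∀ {N} (H : Graph N) {u v : Fin N} → Within H 1 u v → u ≡ v ⊎ H u v ≡ true
within-1 H here          = inj₁ refl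
within-1 H (step e here) = inj₂ e

independent-set-colouring : ∀ {N} (H : Graph N) (I : Subset N) → IsIndependent H I
                          → χρ≤ H (suc (N ∸ ∣ I ∣))
independent-set-colouring {N} H I I-indep =
  suc ∣ ∁ I ∣ , ≤-reflexive (cong suc (∣∁p∣≡n∸∣p∣ I)) , colour , packing
  where
    colourBy : (v : Fin N) → Dec (v ∈ I) → Fin (suc ∣ ∁ I ∣)
    colourBy v (yes _)  = zero
    colourBy v (no v∉I) = suc (rank (∁ I) (x∉p⇒x∈∁p v∉I))

    colour : Fin N → Fin (suc ∣ ∁ I ∣)
    colour v = colourBy v (v ∈? I)

    packing : IsPackingColoring H (suc ∣ ∁ I ∣) colour
    packing u v u≢v same with u ∈? I | v ∈? I
    ... | yes u∈I | yes v∈I = λ near → case within-1 H near of λ where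
            (inj₁ u≡v)  → u≢v u≡v
            (inj₂ edge) → case trans (sym edge) (I-indep u v u∈I v∈I) of λ ()
    ... | no _    | no _    =
            ⊥-elim (u≢v (rank-injective (∁ I) _ _ (suc-injective same)))
    ... | yes _   | no _    with () ← same
    ... | no _    | yes _   with () ← same

∣p++q∣ : ∀ {m n} (p : Subset m) (q : Subset n) → ∣ p ++ q ∣ ≡ ∣ p ∣ + ∣ q ∣
∣p++q∣ []            q = refl
∣p++q∣ (inside  ∷ p) q = cong suc (∣p++q∣ p q)
∣p++q∣ (outside ∷ p) q = ∣p++q∣ p q

_∪′_ : ∀ {n} → Subset n → Subset n → Subset (suc (n + n))
P ∪′ Q = outside ∷ (P ++ Q)

InKind : ∀ {n} → Subset n → Subset n → MKind n → Set
InKind P Q (orig x) = x ∈ P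
InKind P Q (copy x) = x ∈ Q
InKind P Q wv       = ⊥

∪′-member : ∀ {n} (P Q : Subset n) (u : MVertex n) → u ∈ P ∪′ Q → InKind P Q (kind u)
∪′-member {n} P Q (suc i) (there i∈P++Q)
  with splitAt n i | lookup-splitAt n P Q i
... | inj₁ x | lookup≡ = lookup⇒[]= x P (trans (sym lookup≡) ([]=⇒lookup i∈P++Q))
... | inj₂ y | lookup≡ = lookup⇒[]= y Q (trans (sym lookup≡) ([]=⇒lookup i∈P++Q))

-- P ∪ Q' is independent in M(G) when P is independent in G and no edge of G
-- joins P to Q: the edges of M(G) inside V ∪ V' are those of G between V and
-- V ∪ V', and V' itself is independent.
∪′-independent : ∀ {n} (G : Graph n) → (∀ x y → G x y ≡ G y x)
               → (P Q : Subset n) → IsIndependent G P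
               → (∀ x y → x ∈ P → y ∈ Q → G x y ≡ false)
               → IsIndependent (Mycielskian G) (P ∪′ Q)
∪′-independent G symmetric P Q P-indep no-cross u v u∈ v∈ =
  kinds-independent (kind u) (kind v) (∪′-member P Q u u∈) (∪′-member P Q v v∈)
  where
    kinds-independent : ∀ a b → InKind P Q a → InKind P Q b → MAdj G a b ≡ false
    kinds-independent (orig x) (orig y) x∈P y∈P = P-indep x y x∈P y∈P
    kinds-independent (orig x) (copy y) x∈P y∈Q = no-cross x y x∈P y∈Q
    kinds-independent (copy x) (orig y) x∈Q y∈P = trans (symmetric x y) (no-cross y x y∈P x∈Q)
    kinds-independent (copy x) (copy y) _   _   = refl

mycielski-colouring : ∀ {n} (G : Graph n) → (∀ x y → G x y ≡ G y x)
                    → (P Q : Subset n) → IsIndependent G P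
                    → (∀ x y → x ∈ P → y ∈ Q → G x y ≡ false)
                    → χρ≤ (Mycielskian G) (suc (suc (n + n) ∸ (∣ P ∣ + ∣ Q ∣)))
mycielski-colouring G symmetric P Q P-indep no-cross =
  subst (λ size → χρ≤ (Mycielskian G) (suc (_ ∸ size))) (∣p++q∣ P Q)
        (independent-set-colouring (Mycielskian G) (P ∪′ Q)
           (∪′-independent G symmetric P Q P-indep no-cross))

copies-count : ∀ n → suc (suc (n + n) ∸ (∣ ∅ {n} ∣ + ∣ ⊤ {n} ∣)) ≡ n + 2
copies-count n = begin
  suc (suc (n + n) ∸ (∣ ∅ {n} ∣ + ∣ ⊤ {n} ∣)) ≡⟨ cong (λ k → suc (suc (n + n) ∸ k)) (cong₂ _+_ (∣⊥∣≡0 n) (∣⊤∣≡n n)) ⟩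
  suc (suc n + n ∸ n)                         ≡⟨ cong suc (m+n∸n≡m (suc n) n) ⟩
  suc (suc n)                                 ≡⟨ +-comm 2 n ⟩
  n + 2                                       ∎
  where open ≡-Reasoning

double-∸ : ∀ {a n} → a ≤ n → suc (n + n) ∸ (a + a) ≡ suc ((n ∸ a) + (n ∸ a))
double-∸ {zero}  {n}     _          = refl
double-∸ {suc a} {suc n} (s≤s a≤n) = begin
  suc (suc n + suc n) ∸ (suc a + suc a) ≡⟨ cong₂ (λ (m k : ℕ) → suc m ∸ k) (+-suc n n) (+-suc a a) ⟩
  suc (n + n) ∸ (a + a)                 ≡⟨ double-∸ a≤n ⟩
  suc ((n ∸ a) + (n ∸ a))               ∎
  where open ≡-Reasoning

doubled-count : ∀ {a n} → a ≤ n → suc (suc (n + n) ∸ (a + a)) ≡ 2 * (n ∸ a + 1)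
doubled-count {a} {n} a≤n =
  trans (cong suc (double-∸ a≤n)) (two-plus-double (n ∸ a))
  where
    two-plus-double : ∀ d → suc (suc (d + d)) ≡ 2 * (d + 1)
    two-plus-double = solve-∀

χρ≤-⊓ : ∀ {N} {H : Graph N} {m m′ : ℕ} → χρ≤ H m → χρ≤ H m′ → χρ≤ H (m ⊓ m′)
χρ≤-⊓ {H = H} {m} {m′} χ≤m χ≤m′ with ⊓-sel m m′
... | inj₁ min≡m  = subst (χρ≤ H) (sym min≡m) χ≤m
... | inj₂ min≡m′ = subst (χρ≤ H) (sym min≡m′) χ≤m′

proposition2p5 : ∀ {n : ℕ} (G : Graph n) → IsSimple G → Connected G → 2 ≤ n
               → (a : ℕ) → IsIndependenceNumber G a
               → χρ≤ (Mycielskian G) ((n + 2) ⊓ (2 * (n ∸ a + 1)))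
proposition2p5 {n} G (symmetric , _) _ _ a ((S , S-indep , ∣S∣≡a) , _) =
  χρ≤-⊓ (subst (χρ≤ M) (copies-count n) copies-bound)
        (subst (χρ≤ M) (doubled-count a≤n) doubled-bound)
  where
    M : Graph (suc (n + n))
    M = Mycielskian G

    a≤n : a ≤ n
    a≤n = subst (_≤ n) ∣S∣≡a (∣p∣≤n S)

    copies-bound : χρ≤ M (suc (suc (n + n) ∸ (∣ ∅ {n} ∣ + ∣ ⊤ {n} ∣)))
    copies-bound = mycielski-colouring G symmetric ∅ ⊤ nothing-from-∅ nothing-from-∅
      where
        nothing-from-∅ : ∀ {Q : Subset n} x y → x ∈ ∅ → y ∈ Q → G x y ≡ false
        nothing-from-∅ x _ x∈∅ _ = ⊥-elim (∉⊥ x∈∅)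

    doubled-bound : χρ≤ M (suc (suc (n + n) ∸ (a + a)))
    doubled-bound = subst (λ k → χρ≤ M (suc (suc (n + n) ∸ (k + k)))) ∣S∣≡a
                      (mycielski-colouring G symmetric S S S-indep S-indep)
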